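{- A connected lattice path matroid $M[P,Q]$ on at least two elements has a spanning circuit.
   Context: Lattice paths start at $(0,0)$ and use steps $E=(1,0)$ and $N=(0,1)$. For lattice paths $P,Q$ from $(0,0)$ to $(m,r)$ with $P$ never going above $Q$, let $\mathcal{P}$ be the set of lattice paths from $(0,0)$ to $(m,r)$ going neither above $Q$ nor below $P$, and for $1\le i\le r$ let $N_i=\{j:\text{step } j \text{ is the } i\text{ -th North step of some path in }\mathcal{P}\}$. $M[P,Q]$ is the transversal matroid on $[m+r]$ with presentation $(N_1,\ldots,N_r)$. A spanning circuit is a circuit whose closure is the whole ground set. -}

module Defs where

open import Data.Nat using (ℕ; zero; suc; _+_; _≤_)
open import Data.Fin using (Fin; toℕ)
open import Data.Fin.Subset using (Subset; _∈_; _⊆_; _⊂_; _∪_; ⁅_⁆; ∣_∣)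
open import Data.Vec using (Vec; []; _∷_; lookup)
open import Data.Product using (Σ; ∃; _×_)
open import Relation.Binary.PropositionalEquality using (_≡_; _≢_)
open import Relation.Nullary using (¬_)

data Step : Set where
  E N : Step

nOf : Step → ℕ
nOf E = 0
nOf N = 1

height : ∀ {n} → ℕ → Vec Step n → ℕ
height zero    _       = 0
height (suc k) []      = 0
height (suc k) (s ∷ v) = nOf s + height k v

northCount : ∀ {n} → Vec Step n → ℕ
northCount {n} v = height n v

-- A lattice path from (0,0) to (m,r): a word of length m + r in E,N with
-- exactly r North steps (hence exactly m East steps).
IsPath : (m r : ℕ) → Vec Step (m + r) → Set
IsPath m r v = northCount v ≡ r

NotAbove : ∀ {n} → Vec Step n → Vec Step n → Set
NotAbove P Q = ∀ k → height k P ≤ height k Q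

InRegion : (m r : ℕ) → (P Q R : Vec Step (m + r)) → Set
InRegion m r P Q R = IsPath m r R × NotAbove R Q × NotAbove P R

-- N_i : step j (0-indexed Fin) is the i-th North step (i 0-indexed) of some
-- path in the region
NSet : (m r : ℕ) → (P Q : Vec Step (m + r)) → Fin r → Fin (m + r) → Set
NSet m r P Q i j =
  Σ (Vec Step (m + r)) λ R →
    InRegion m r P Q R × lookup R j ≡ N × height (toℕ j) R ≡ toℕ i

TransversalIndep : ∀ {n r} → (Fin r → Fin n → Set) → Subset n → Set
TransversalIndep {n} {r} A X =
  Σ ((x : Fin n) → x ∈ X → Fin r) λ f →
    (∀ x y (px : x ∈ X) (py : y ∈ X) → f x px ≡ f y py → x ≡ y) ×
    (∀ x (px : x ∈ X) → A (f x px) x)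

LPMIndep : (m r : ℕ) → (P Q : Vec Step (m + r)) → Subset (m + r) → Set
LPMIndep m r P Q = TransversalIndep (NSet m r P Q)

module MatroidNotions {n : ℕ} (Indep : Subset n → Set) where

  Circuit : Subset n → Set
  Circuit C = ¬ Indep C × (∀ D → D ⊂ C → Indep D)

  HasRank : Subset n → ℕ → Set
  HasRank X k =
    (Σ (Subset n) λ I → I ⊆ X × Indep I × ∣ I ∣ ≡ k) ×
    (∀ I → I ⊆ X → Indep I → ∣ I ∣ ≤ k)

  InClosure : Subset n → Fin n → Set
  InClosure X e = ∀ k → HasRank X k → HasRank (X ∪ ⁅ e ⁆) k

  Spanning : Subset n → Set
  Spanning C = ∀ e → InClosure C e

  SpanningCircuit : Subset n → Set
  SpanningCircuit C = Circuit C × Spanning C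

  Connected : Set
  Connected = ∀ e f → e ≢ f → Σ (Subset n) λ C → Circuit C × e ∈ C × f ∈ C

-- Connectedness keeps P strictly below Q away from the endpoints: if they touch after t steps,
-- every path of the region passes through that lattice point, so M[P,Q] is the direct sum of its
-- restrictions to the steps before and after t, and no circuit meets both sides. Then the last
-- step l of Q is East, and C = (North steps of Q) ∪ {l} is a spanning circuit: it has r + 1
-- elements in a matroid of rank r, it contains the basis of North steps of Q, and removing a
-- North step y of Q leaves the North steps of the region path that turns East at y and catches
-- up with Q at the last step.
module Submission where

open import Defs
open import Data.Nat using (ℕ; zero; suc; _+_; _≤_; _<_; z≤n; s≤s)
open import Data.Nat.Properties
open import Data.Fin using (Fin; toℕ; zero; suc; punchOut; fromℕ<; fromℕ)
open import Data.Fin.Properties using (punchOut-injective; toℕ-injective; toℕ<n; toℕ-fromℕ<; toℕ-fromℕ) renaming (suc-injective to Fin-suc-injective)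
open import Data.Fin.Subset using (Subset; Side; _∈_; _∉_; inside; outside; ∣_∣; _─_; ∁; _⊆_; _⊂_; ⁅_⁆) renaming (⊥ to ∅)
open import Data.Fin.Subset.Properties using (_∈?_; ∉⊥; x∈p∩q⁺; x∈p∧x∉q⇒x∈p─q; x∈p⇒x∉∁p; x∉p⇒x∈∁p; p∩q≢∅⇒p─q⊂p; p⊆p∪q)
open import Data.Vec using (Vec; []; _∷_; here; there; lookup; map; _[_]≔_)
open import Data.Vec.Properties using (lookup∘update′)
open import Data.Product using (Σ; _×_; _,_)
open import Data.Sum using (_⊎_; inj₁; inj₂)
open import Data.Empty using (⊥; ⊥-elim)
open import Relation.Binary.PropositionalEquality
open import Relation.Binary.Definitions using (tri<; tri≈; tri>)
open import Relation.Nullary using (¬_; yes; no; contradiction)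
open import Function using (_∘′_)

height-mono : ∀ {n} (v : Vec Step n) {a b} → a ≤ b → height a v ≤ height b v
height-mono v       {zero}          _         = z≤n
height-mono []      {suc a} {suc b} _         = z≤n
height-mono (s ∷ v) {suc a} {suc b} (s≤s a≤b) = +-monoʳ-≤ (nOf s) (height-mono v a≤b)

height-suc-≤ : ∀ {n} (v : Vec Step n) k → height (suc k) v ≤ suc (height k v)
height-suc-≤ []      k       = z≤n
height-suc-≤ (E ∷ v) zero    = z≤n
height-suc-≤ (N ∷ v) zero    = ≤-refl
height-suc-≤ (s ∷ v) (suc k) =
  ≤-trans (+-monoʳ-≤ (nOf s) (height-suc-≤ v k)) (≤-reflexive (+-suc (nOf s) _))

north-height-< : ∀ {n} (v : Vec Step n) {j k} → lookup v j ≡ N → toℕ j < k → height (toℕ j) v < height k v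
north-height-< (N ∷ v) {zero}  {suc k} refl _          = s≤s z≤n
north-height-< (s ∷ v) {suc j} {suc k} vj   (s≤s j<k) = +-monoʳ-< (nOf s) (north-height-< v vj j<k)

north-height-injective : ∀ {n} (v : Vec Step n) {x y} → lookup v x ≡ N → lookup v y ≡ N →
  height (toℕ x) v ≡ height (toℕ y) v → x ≡ y
north-height-injective v {x} {y} vx vy eq with <-cmp (toℕ x) (toℕ y)
... | tri< x<y _ _ = contradiction eq (<⇒≢ (north-height-< v vx x<y))
... | tri≈ _ x≡y _ = toℕ-injective x≡y
... | tri> _ _ y<x = contradiction (sym eq) (<⇒≢ (north-height-< v vy y<x))

height-[]≔-≤ : ∀ {n} (v : Vec Step n) j s {k} → k ≤ toℕ j → height k (v [ j ]≔ s) ≡ height k v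
height-[]≔-≤ v       j       s {zero}  _         = refl
height-[]≔-≤ (x ∷ v) (suc j) s {suc k} (s≤s k≤j) = cong (nOf x +_) (height-[]≔-≤ v j s k≤j)

height-lower : ∀ {n} (v : Vec Step n) j {k} → lookup v j ≡ N → toℕ j < k →
  suc (height k (v [ j ]≔ E)) ≡ height k v
height-lower (N ∷ v) zero    {suc k} refl _         = refl
height-lower (x ∷ v) (suc j) {suc k} vj   (s≤s j<k) =
  trans (sym (+-suc (nOf x) _)) (cong (nOf x +_) (height-lower v j vj j<k))

height-raise : ∀ {n} (v : Vec Step n) j {k} → lookup v j ≡ E → toℕ j < k →
  height k (v [ j ]≔ N) ≡ suc (height k v)
height-raise (E ∷ v) zero    {suc k} refl _         = refl
height-raise (x ∷ v) (suc j) {suc k} vj   (s≤s j<k) =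
  trans (cong (nOf x +_) (height-raise v j vj j<k)) (+-suc (nOf x) _)

isN : Step → Side
isN E = outside
isN N = inside

northSteps : ∀ {n} → Vec Step n → Subset n
northSteps = map isN

∣northSteps∣ : ∀ {n} (v : Vec Step n) → ∣ northSteps v ∣ ≡ northCount v
∣northSteps∣ []      = refl
∣northSteps∣ (E ∷ v) = ∣northSteps∣ v
∣northSteps∣ (N ∷ v) = cong suc (∣northSteps∣ v)

∈northSteps⁻ : ∀ {n} {v : Vec Step n} {x} → x ∈ northSteps v → lookup v x ≡ N
∈northSteps⁻ {v = N ∷ v} {zero}  here      = refl
∈northSteps⁻ {v = s ∷ v} {suc x} (there p) = ∈northSteps⁻ p

∈northSteps⁺ : ∀ {n} {v : Vec Step n} {x} → lookup v x ≡ N → x ∈ northSteps v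
∈northSteps⁺ {v = N ∷ v} {zero}  refl = here
∈northSteps⁺ {v = s ∷ v} {suc x} vx   = there (∈northSteps⁺ vx)

below : ∀ {n} → ℕ → Subset n
below {zero}  _       = []
below {suc n} zero    = ∅
below {suc n} (suc t) = inside ∷ below t

∈below⇒< : ∀ {n t} {x : Fin n} → x ∈ below t → toℕ x < t
∈below⇒< {suc n} {zero}          x∈ = contradiction x∈ ∉⊥
∈below⇒< {suc n} {suc t} {zero}  here       = s≤s z≤n
∈below⇒< {suc n} {suc t} {suc x} (there x∈) = s≤s (∈below⇒< x∈)

<⇒∈below : ∀ {n t} {x : Fin n} → toℕ x < t → x ∈ below t
<⇒∈below {suc n} {suc t} {zero}  _         = here
<⇒∈below {suc n} {suc t} {suc x} (s≤s x<t) = there (<⇒∈below x<t)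

∉below⇒≥ : ∀ {n t} {x : Fin n} → x ∉ below t → t ≤ toℕ x
∉below⇒≥ x∉ = ≮⇒≥ (λ x<t → x∉ (<⇒∈below x<t))

≥⇒∉below : ∀ {n t} {x : Fin n} → t ≤ toℕ x → x ∉ below t
≥⇒∉below t≤x x∈ = <⇒≱ (∈below⇒< x∈) t≤x

injection⇒∣p∣≤ : ∀ {n r} (X : Subset n) (f : (x : Fin n) → x ∈ X → Fin r) →
  (∀ x y (x∈X : x ∈ X) (y∈X : y ∈ X) → f x x∈X ≡ f y y∈X → x ≡ y) → ∣ X ∣ ≤ r
injection⇒∣p∣≤ []            f f-inj = z≤n
injection⇒∣p∣≤ (outside ∷ X) f f-inj =
  injection⇒∣p∣≤ X (λ x x∈X → f (suc x) (there x∈X))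
                   (λ x y _ _ eq → Fin-suc-injective (f-inj _ _ _ _ eq))
injection⇒∣p∣≤ {r = zero}  (inside ∷ X) f f-inj with () ← f zero here
injection⇒∣p∣≤ {r = suc r} (inside ∷ X) f f-inj = s≤s (injection⇒∣p∣≤ X g g-inj)
  where
  f0≢ : ∀ x (x∈X : x ∈ X) → f zero here ≢ f (suc x) (there x∈X)
  f0≢ x x∈X eq with () ← f-inj _ _ _ _ eq
  g : (x : Fin _) → x ∈ X → Fin r
  g x x∈X = punchOut (f0≢ x x∈X)
  g-inj : ∀ x y (x∈X : x ∈ X) (y∈X : y ∈ X) → g x x∈X ≡ g y y∈X → x ≡ y
  g-inj x y x∈X y∈X eq = Fin-suc-injective (f-inj _ _ _ _ (punchOut-injective (f0≢ x x∈X) (f0≢ y y∈X) eq))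

module _ {n r} (A : Fin r → Fin n → Set) where

  TransversalIndep⇒∣p∣≤r : ∀ {X} → TransversalIndep A X → ∣ X ∣ ≤ r
  TransversalIndep⇒∣p∣≤r {X} (f , f-inj , _) = injection⇒∣p∣≤ X f f-inj

  independent-by-split : (X S : Subset n) →
    (∀ {i x y} → x ∈ S → y ∉ S → A i x → A i y → ⊥) →
    TransversalIndep A (X ─ ∁ S) → TransversalIndep A (X ─ S) → TransversalIndep A X
  independent-by-split X S disjoint (f , f-inj , f-valid) (g , g-inj , g-valid) = h , h-inj , h-valid
    where
    h : (x : Fin n) → x ∈ X → Fin r
    h x x∈X with x ∈? S
    ... | yes x∈S = f x (x∈p∧x∉q⇒x∈p─q x∈X (x∈p⇒x∉∁p x∈S))
    ... | no  x∉S = g x (x∈p∧x∉q⇒x∈p─q x∈X x∉S)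

    h-valid : ∀ x (x∈X : x ∈ X) → A (h x x∈X) x
    h-valid x x∈X with x ∈? S
    ... | yes _ = f-valid x _
    ... | no  _ = g-valid x _

    h-inj : ∀ x y (x∈X : x ∈ X) (y∈X : y ∈ X) → h x x∈X ≡ h y y∈X → x ≡ y
    h-inj x y x∈X y∈X eq with x ∈? S | y ∈? S
    ... | yes _   | yes _   = f-inj x y _ _ eq
    ... | no  _   | no  _   = g-inj x y _ _ eq
    ... | yes x∈S | no  y∉S =
      ⊥-elim (disjoint x∈S y∉S (f-valid x _) (subst (λ i → A i y) (sym eq) (g-valid y _)))
    ... | no  x∉S | yes y∈S =
      ⊥-elim (disjoint y∈S x∉S (f-valid y _) (subst (λ i → A i x) eq (g-valid x _)))

module _ {n} (Indep : Subset n → Set) where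
  open MatroidNotions Indep

  ⊇maximumIndependent⇒spanning : ∀ {C I} → I ⊆ C → Indep I →
                                 (∀ J → Indep J → ∣ J ∣ ≤ ∣ I ∣) → Spanning C
  ⊇maximumIndependent⇒spanning {I = I} I⊆C indI maximum e k
                               ((I′ , I′⊆C , indI′ , ∣I′∣≡k) , bound) =
    (I′ , (λ x∈I′ → p⊆p∪q ⁅ e ⁆ (I′⊆C x∈I′)) , indI′ , ∣I′∣≡k) ,
    λ J _ indJ → ≤-trans (maximum J indJ) (bound I I⊆C indI)

lastIndex : ∀ {n} → 2 ≤ n → Σ (Fin n) λ l → suc (toℕ l) ≡ n × 1 ≤ toℕ l
lastIndex {suc (suc n)} (s≤s (s≤s _)) = fromℕ (suc n) , cong suc (toℕ-fromℕ (suc n)) , s≤s z≤n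

module _ (m r : ℕ) (P Q : Vec Step (m + r)) where
  open MatroidNotions (LPMIndep m r P Q)

  northSteps-independent : ∀ {R X} → InRegion m r P Q R → X ⊆ northSteps R → LPMIndep m r P Q X
  northSteps-independent {R} {X} region@(R-path , _ , _) X⊆ = index , index-injective , index-valid
    where
    north : ∀ {x} → x ∈ X → lookup R x ≡ N
    north x∈X = ∈northSteps⁻ (X⊆ x∈X)

    height<r : ∀ {x} → x ∈ X → height (toℕ x) R < r
    height<r {x} x∈X = subst (height (toℕ x) R <_) R-path (north-height-< R (north x∈X) (toℕ<n x))

    index : (x : Fin (m + r)) → x ∈ X → Fin r
    index x x∈X = fromℕ< (height<r x∈X)

    index-injective : ∀ x y (x∈X : x ∈ X) (y∈X : y ∈ X) → index x x∈X ≡ index y y∈X → x ≡ y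
    index-injective x y x∈X y∈X eq = north-height-injective R (north x∈X) (north y∈X) (begin
      height (toℕ x) R      ≡⟨ toℕ-fromℕ< (height<r x∈X) ⟨
      toℕ (index x x∈X)     ≡⟨ cong toℕ eq ⟩
      toℕ (index y y∈X)     ≡⟨ toℕ-fromℕ< (height<r y∈X) ⟩
      height (toℕ y) R      ∎)
      where open ≡-Reasoning

    index-valid : ∀ x (x∈X : x ∈ X) → NSet m r P Q (index x x∈X) x
    index-valid x x∈X = R , region , north x∈X , sym (toℕ-fromℕ< (height<r x∈X))

  module _ {t} (touch : height t P ≡ height t Q) where

    region-height : ∀ {R} → InRegion m r P Q R → height t R ≡ height t Q
    region-height {R} (_ , R≤Q , P≤R) = ≤-antisym (R≤Q t) (subst (_≤ height t R) touch (P≤R t))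

    index-before : ∀ {i x} → NSet m r P Q i x → toℕ x < t → toℕ i < height t Q
    index-before (R , region , Rx , hx) x<t = subst₂ _<_ hx (region-height region) (north-height-< R Rx x<t)

    index-after : ∀ {i x} → NSet m r P Q i x → t ≤ toℕ x → height t Q ≤ toℕ i
    index-after (R , region , _ , hx) t≤x = subst₂ _≤_ (region-height region) hx (height-mono R t≤x)

    circuit-does-not-cross : ∀ {C e f} → Circuit C → e ∈ C → f ∈ C → toℕ e < t → t ≤ toℕ f → ⊥
    circuit-does-not-cross {C} {e} {f} (dependent , minimal) e∈C f∈C e<t t≤f =
      dependent (independent-by-split (NSet m r P Q) C (below t) index-disjoint
        (minimal _ (p∩q≢∅⇒p─q⊂p C (∁ (below t)) (f , x∈p∩q⁺ (f∈C , x∉p⇒x∈∁p (≥⇒∉below t≤f)))))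
        (minimal _ (p∩q≢∅⇒p─q⊂p C (below t) (e , x∈p∩q⁺ (e∈C , <⇒∈below e<t)))))
      where
      index-disjoint : ∀ {i x y} → x ∈ below t → y ∉ below t →
                       NSet m r P Q i x → NSet m r P Q i y → ⊥
      index-disjoint x∈ y∉ Nix Niy =
        <⇒≱ (index-before Nix (∈below⇒< x∈)) (index-after Niy (∉below⇒≥ y∉))

  StrictlyBelowInside : Set
  StrictlyBelowInside = ∀ k → 1 ≤ k → k < m + r → height k P < height k Q

  connected⇒strictlyBelowInside : NotAbove P Q → Connected → StrictlyBelowInside
  connected⇒strictlyBelowInside P≤Q connected k 1≤k k<n with m≤n⇒m<n∨m≡n (P≤Q k)
  ... | inj₁ P<Q  = P<Q
  ... | inj₂ touch = ⊥-elim (no-crossing-circuit (connected e f (<⇒≢ e<f ∘′ cong toℕ)))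
    where
    0<n : 0 < m + r
    0<n = <-trans 1≤k k<n
    e f : Fin (m + r)
    e = fromℕ< 0<n
    f = fromℕ< k<n
    e<f : toℕ e < toℕ f
    e<f = subst₂ _<_ (sym (toℕ-fromℕ< 0<n)) (sym (toℕ-fromℕ< k<n)) 1≤k
    no-crossing-circuit : ¬ Σ (Subset (m + r)) (λ C → Circuit C × e ∈ C × f ∈ C)
    no-crossing-circuit (C , circuit , e∈C , f∈C) =
      circuit-does-not-cross touch circuit e∈C f∈C
        (subst (toℕ e <_) (toℕ-fromℕ< k<n) e<f) (≤-reflexive (sym (toℕ-fromℕ< k<n)))

  module SpanningCircuit (P-path : IsPath m r P) (Q-path : IsPath m r Q)
           (P≤Q : NotAbove P Q) (P<Q : StrictlyBelowInside)
           {l : Fin (m + r)} (l-last : suc (toℕ l) ≡ m + r) (1≤l : 1 ≤ toℕ l) where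

    l<n : toℕ l < m + r
    l<n = toℕ<n l

    Q-ends-east : lookup Q l ≡ E
    Q-ends-east with lookup Q l in Ql
    ... | E = refl
    ... | N = contradiction (begin-strict
      r                        ≡⟨ P-path ⟨
      height (m + r) P         ≡⟨ cong (λ k → height k P) l-last ⟨
      height (suc (toℕ l)) P   ≤⟨ height-suc-≤ P (toℕ l) ⟩
      suc (height (toℕ l) P)   ≤⟨ P<Q (toℕ l) 1≤l l<n ⟩
      height (toℕ l) Q         <⟨ north-height-< Q Ql l<n ⟩
      height (m + r) Q         ≡⟨ Q-path ⟩
      r                        ∎) (<-irrefl refl)
      where open ≤-Reasoning

    W : Vec Step (m + r)
    W = Q [ l ]≔ N

    C : Subset (m + r)
    C = northSteps W

    ∣C∣≡1+r : ∣ C ∣ ≡ suc r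
    ∣C∣≡1+r = begin
      ∣ northSteps W ∣       ≡⟨ ∣northSteps∣ W ⟩
      height (m + r) W       ≡⟨ height-raise Q l Q-ends-east l<n ⟩
      suc (height (m + r) Q) ≡⟨ cong suc Q-path ⟩
      suc r                  ∎
      where open ≡-Reasoning

    module _ {y : Fin (m + r)} (Wy : lookup W y ≡ N) where

      R : Vec Step (m + r)
      R = W [ y ]≔ E

      y≤l : toℕ y ≤ toℕ l
      y≤l = ≤-pred (subst (toℕ y <_) (sym l-last) (toℕ<n y))

      -- For y = l the middle range (y, l] is empty and R has the same heights as Q.
      R-height : ∀ k → height k R ≡ height k Q ⊎ (suc (height k R) ≡ height k Q × 1 ≤ k × k < m + r)
      R-height k with k ≤? toℕ y | k ≤? toℕ l
      ... | yes k≤y | _ =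
        inj₁ (trans (height-[]≔-≤ W y E k≤y) (height-[]≔-≤ Q l N (≤-trans k≤y y≤l)))
      ... | no k≰y | yes k≤l =
        inj₂ ( trans (height-lower W y Wy (≰⇒> k≰y)) (height-[]≔-≤ Q l N k≤l)
             , ≤-trans (s≤s z≤n) (≰⇒> k≰y)
             , ≤-<-trans k≤l l<n )
      ... | no k≰y | no k≰l =
        inj₁ (suc-injective (trans (height-lower W y Wy (≰⇒> k≰y))
                                   (height-raise Q l Q-ends-east (≰⇒> k≰l))))

      R-inRegion : InRegion m r P Q R
      R-inRegion = R-path , R≤Q , P≤R
        where
        R-path : IsPath m r R
        R-path with R-height (m + r)
        ... | inj₁ R≡Q = trans R≡Q Q-path
        ... | inj₂ (_ , _ , n<n) = contradiction n<n (<-irrefl refl)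
        R≤Q : NotAbove R Q
        R≤Q k with R-height k
        ... | inj₁ R≡Q = ≤-reflexive R≡Q
        ... | inj₂ (1+R≡Q , _) = subst (height k R ≤_) 1+R≡Q (n≤1+n _)
        P≤R : NotAbove P R
        P≤R k with R-height k
        ... | inj₁ R≡Q = subst (height k P ≤_) (sym R≡Q) (P≤Q k)
        ... | inj₂ (1+R≡Q , 1≤k , k<n) = ≤-pred (subst (height k P <_) (sym 1+R≡Q) (P<Q k 1≤k k<n))

    C-circuit : Circuit C
    C-circuit = C-dependent , C-minimal
      where
      C-dependent : ¬ LPMIndep m r P Q C
      C-dependent indC = 1+n≰n (subst (_≤ r) ∣C∣≡1+r (TransversalIndep⇒∣p∣≤r (NSet m r P Q) indC))
      C-minimal : ∀ D → D ⊂ C → LPMIndep m r P Q D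
      C-minimal D (D⊆C , y , y∈C , y∉D) = northSteps-independent (R-inRegion Wy) D⊆
        where
        Wy : lookup W y ≡ N
        Wy = ∈northSteps⁻ y∈C
        D⊆ : D ⊆ northSteps (R Wy)
        D⊆ {z} z∈D =
          ∈northSteps⁺ (trans (lookup∘update′ (λ { refl → y∉D z∈D }) W E) (∈northSteps⁻ (D⊆C z∈D)))

    C-spanning : Spanning C
    C-spanning = ⊇maximumIndependent⇒spanning (LPMIndep m r P Q) northQ⊆C
      (northSteps-independent (Q-path , (λ _ → ≤-refl) , P≤Q) (λ x∈ → x∈))
      (λ J indJ → subst (∣ J ∣ ≤_) (sym (trans (∣northSteps∣ Q) Q-path))
                                   (TransversalIndep⇒∣p∣≤r (NSet m r P Q) indJ))
      where
      northQ⊆C : northSteps Q ⊆ C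
      northQ⊆C {x} x∈ = ∈northSteps⁺ (trans (lookup∘update′ x≢l Q N) Qx)
        where
        Qx : lookup Q x ≡ N
        Qx = ∈northSteps⁻ x∈
        x≢l : x ≢ l
        x≢l refl with () ← trans (sym Qx) Q-ends-east

  strictlyBelowInside⇒spanningCircuit : IsPath m r P → IsPath m r Q → NotAbove P Q →
    StrictlyBelowInside → 2 ≤ m + r → Σ (Subset (m + r)) SpanningCircuit
  strictlyBelowInside⇒spanningCircuit P-path Q-path P≤Q P<Q 2≤n with lastIndex 2≤n
  ... | l , l-last , 1≤l = C , C-circuit , C-spanning
    where open SpanningCircuit P-path Q-path P≤Q P<Q l-last 1≤l

theorem3p3 : (m r : ℕ) (P Q : Vec Step (m + r)) →
    IsPath m r P → IsPath m r Q → NotAbove P Q →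
    MatroidNotions.Connected (LPMIndep m r P Q) →
    2 ≤ m + r →
    Σ (Subset (m + r)) (MatroidNotions.SpanningCircuit (LPMIndep m r P Q))
theorem3p3 m r P Q P-path Q-path P≤Q connected =
  strictlyBelowInside⇒spanningCircuit m r P Q P-path Q-path P≤Q
    (connected⇒strictlyBelowInside m r P Q P≤Q connected)
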